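{- Let $A$ be a maximal residuated lattice and $e\in B(A)$. Then $\langle e\rangle$ is a maximal residuated lattice.
   Context: A residuated lattice is a commutative integral residuated bounded lattice $(A,\vee,\wedge,\odot,\rightarrow,0,1)$ (bounded lattice, commutative monoid $(A,\odot,1)$, $a\le b\rightarrow c$ iff $a\odot b\le c$). A filter is a nonempty subset closed under $\odot$ and upward closed. For a filter $F$, $a\equiv b\pmod F$ iff $(a\rightarrow b)\wedge(b\rightarrow a)\in F$. $A$ is maximal iff whenever $\{(a_i,F_i)\}_{i\in I}$ ($a_i\in A$, $F_i$ filters) is such that every finite subfamily of the congruences $x\equiv a_i\pmod{F_i}$ has a common solution in $A$, the whole family has a common solution in $A$. $B(A)$ is the set of complemented elements of the lattice $(A,\vee,\wedge,0,1)$. For $e\in B(A)$, $\langle e\rangle$ is the residuated lattice with universe $\{a\in A\mid e\le a\}$, operations $\vee,\wedge,\odot$ inherited from $A$, implication $a\rightarrow_e b=e\vee(a\rightarrow b)$, least element $e$, greatest element $1$ (maximality of $\langle e\rangle$ refers to its own filters and congruences). -}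

module Defs where

open import Level using (Level; _⊔_) renaming (suc to lsuc)
open import Data.Product using (Σ; Σ-syntax; ∃; _×_; _,_; proj₁; proj₂)
open import Relation.Binary.Core using (Rel)
open import Relation.Binary.Structures using (IsPartialOrder)
open import Relation.Binary.Lattice.Structures using (IsBoundedLattice)
open import Algebra.Core using (Op₂)
open import Algebra.Structures using (IsCommutativeMonoid)
open import Data.List using (List)
open import Data.List.Membership.Propositional using (_∈_)

record RLSig (c ℓ₁ ℓ₂ : Level) : Set (lsuc (c ⊔ ℓ₁ ⊔ ℓ₂)) where
  infixr 6 _∨_
  infixr 7 _∧_
  infixr 8 _⊙_
  infixr 5 _⇒_
  infix 4 _≈_ _≤_
  field
    Carrier : Set c
    _≈_     : Rel Carrier ℓ₁
    _≤_     : Rel Carrier ℓ₂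
    _∨_     : Op₂ Carrier
    _∧_     : Op₂ Carrier
    _⊙_     : Op₂ Carrier
    _⇒_     : Op₂ Carrier
    𝟘       : Carrier
    𝟙       : Carrier

-- A residuated lattice: bounded lattice (order-theoretic), commutative
-- monoid (A, ⊙, 1) (hence integral since 1 is the top), and
-- residuation  a ≤ b ⇒ c  iff  a ⊙ b ≤ c.
record IsResiduatedLattice {c ℓ₁ ℓ₂} (A : RLSig c ℓ₁ ℓ₂) : Set (c ⊔ ℓ₁ ⊔ ℓ₂) where
  open RLSig A
  field
    isBoundedLattice    : IsBoundedLattice _≈_ _≤_ _∨_ _∧_ 𝟙 𝟘
    isCommutativeMonoid : IsCommutativeMonoid _≈_ _⊙_ 𝟙
    residuation₁        : ∀ a b c → a ≤ (b ⇒ c) → (a ⊙ b) ≤ c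
    residuation₂        : ∀ a b c → (a ⊙ b) ≤ c → a ≤ (b ⇒ c)

module _ {c ℓ₁ ℓ₂} (A : RLSig c ℓ₁ ℓ₂) where
  open RLSig A

  record IsFilter {f} (F : Carrier → Set f) : Set (c ⊔ ℓ₂ ⊔ f) where
    field
      nonempty  : ∃ λ x → F x
      ⊙-closed  : ∀ {x y} → F x → F y → F (x ⊙ y)
      up-closed : ∀ {x y} → x ≤ y → F x → F y

  Congruent : ∀ {f} → (Carrier → Set f) → Carrier → Carrier → Set f
  Congruent F a b = F ((a ⇒ b) ∧ (b ⇒ a))

  IsMaximal : (i f : Level) → Set (c ⊔ ℓ₂ ⊔ lsuc (i ⊔ f))
  IsMaximal i f =
    (I : Set i) (a : I → Carrier) (F : I → Carrier → Set f) →
    (∀ k → IsFilter (F k)) →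
    -- every finite subfamily (indices listed by a finite list ks)
    -- has a common solution
    ((ks : List I) → ∃ λ x → ∀ k → k ∈ ks → Congruent (F k) x (a k)) →
    ∃ λ x → ∀ k → Congruent (F k) x (a k)

  IsComplemented : Carrier → Set (c ⊔ ℓ₁)
  IsComplemented e = ∃ λ f → ((e ∨ f) ≈ 𝟙) × ((e ∧ f) ≈ 𝟘)

module Closure {c ℓ₁ ℓ₂} (A : RLSig c ℓ₁ ℓ₂) (isRL : IsResiduatedLattice A) where
  open RLSig A
  open IsResiduatedLattice isRL
  open IsBoundedLattice isBoundedLattice
    using (refl; reflexive; trans; supremum; infimum; maximum; minimum; x≤x∨y; x∧y≤x; x∧y≤y)
  open IsCommutativeMonoid isCommutativeMonoid
    using (identityˡ; identityʳ; comm) renaming (refl to ≈-refl)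

  ⊙-monoˡ : ∀ {x y} z → x ≤ y → (x ⊙ z) ≤ (y ⊙ z)
  ⊙-monoˡ {x} {y} z x≤y =
    residuation₁ x z (y ⊙ z) (trans x≤y (residuation₂ y z (y ⊙ z) refl))

  ⊙-monoʳ : ∀ {x y} z → x ≤ y → (z ⊙ x) ≤ (z ⊙ y)
  ⊙-monoʳ {x} {y} z x≤y =
    trans (reflexive (comm z x)) (trans (⊙-monoˡ z x≤y) (reflexive (comm y z)))

  x⊙y≤x : ∀ x y → (x ⊙ y) ≤ x
  x⊙y≤x x y = trans (⊙-monoʳ x (maximum y)) (reflexive (identityʳ x))

  x⊙y≤y : ∀ x y → (x ⊙ y) ≤ y
  x⊙y≤y x y = trans (reflexive (comm x y)) (x⊙y≤x y x)

  e≤e⊙e : ∀ e → IsComplemented A e → e ≤ (e ⊙ e)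
  e≤e⊙e e (f , e∨f≈1 , e∧f≈0) =
    trans (reflexive (sym≈ (identityˡ e)))
      (residuation₁ 𝟙 e (e ⊙ e)
        (trans (reflexive (sym≈ e∨f≈1))
          (proj₂ (proj₂ (supremum e f)) (e ⇒ (e ⊙ e))
            (residuation₂ e e (e ⊙ e) refl)
            (residuation₂ f e (e ⊙ e)
              (trans (proj₂ (proj₂ (infimum f e)) (f ⊙ e) (x⊙y≤x f e) (x⊙y≤y f e))
                (trans (reflexive (IsCommutativeMonoid.trans isCommutativeMonoid
                                     (comm-∧ f e) e∧f≈0))
                       (minimum (e ⊙ e))))))))
    where
    sym≈ = IsCommutativeMonoid.sym isCommutativeMonoid
    comm-∧ : ∀ x y → (x ∧ y) ≈ (y ∧ x)
    comm-∧ x y = IsBoundedLattice.antisym isBoundedLattice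
      (proj₂ (proj₂ (infimum y x)) (x ∧ y) (x∧y≤y x y) (x∧y≤x x y))
      (proj₂ (proj₂ (infimum x y)) (y ∧ x) (x∧y≤y y x) (x∧y≤x y x))

  ⊙-closed : ∀ {e a b} → IsComplemented A e → e ≤ a → e ≤ b → e ≤ (a ⊙ b)
  ⊙-closed {e} {a} {b} ce e≤a e≤b =
    trans (e≤e⊙e e ce) (trans (⊙-monoˡ e e≤a) (⊙-monoʳ a e≤b))

  ∨-closed : ∀ {e a b} → e ≤ a → e ≤ (a ∨ b)
  ∨-closed {e} {a} {b} e≤a = trans e≤a (x≤x∨y a b)

  ∧-closed : ∀ {e a b} → e ≤ a → e ≤ b → e ≤ (a ∧ b)
  ∧-closed {e} {a} {b} e≤a e≤b = proj₂ (proj₂ (infimum a b)) e e≤a e≤b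

  ⇒-closed : ∀ {e a b} → e ≤ (e ∨ (a ⇒ b))
  ⇒-closed {e} {a} {b} = x≤x∨y e (a ⇒ b)

⟨_⟩ : ∀ {c ℓ₁ ℓ₂} {A : RLSig c ℓ₁ ℓ₂} → IsResiduatedLattice A →
      (e : RLSig.Carrier A) → IsComplemented A e → RLSig (c ⊔ ℓ₂) ℓ₁ ℓ₂
⟨_⟩ {A = A} isRL e ce = record
  { Carrier = Σ[ a ∈ Carrier ] (e ≤ a)
  ; _≈_     = λ x y → proj₁ x ≈ proj₁ y
  ; _≤_     = λ x y → proj₁ x ≤ proj₁ y
  ; _∨_     = λ x y → (proj₁ x ∨ proj₁ y) , ∨-closed (proj₂ x)
  ; _∧_     = λ x y → (proj₁ x ∧ proj₁ y) , ∧-closed (proj₂ x) (proj₂ y)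
  ; _⊙_     = λ x y → (proj₁ x ⊙ proj₁ y) , ⊙-closed ce (proj₂ x) (proj₂ y)
  ; _⇒_     = λ x y → (e ∨ (proj₁ x ⇒ proj₁ y)) , ⇒-closed
  ; 𝟘       = e , IsBoundedLattice.refl (IsResiduatedLattice.isBoundedLattice isRL)
  ; 𝟙       = 𝟙 , IsBoundedLattice.maximum (IsResiduatedLattice.isBoundedLattice isRL) e
  }
  where
  open RLSig A
  open Closure A isRL

-- The map a ↦ e ∨ a sends A onto ⟨e⟩ and satisfies (e ∨ x) ⊙ (e ∨ y) ≤ e ∨ (x ⊙ y),
-- so every filter F of ⟨e⟩ pulls back to a filter of A.  A finite subsystem of
-- x ≡ aₖ (mod Fₖ) solvable in ⟨e⟩ stays solvable in A modulo the pulled-back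
-- filters; maximality of A gives a global solution y, and e ∨ y solves the
-- original system in ⟨e⟩ because e ≤ aₖ.
module Submission where

open import Defs
open import Level using (Level)
open import Function using (_∘_)
open import Data.Product using (_×_; _,_; proj₁; proj₂; ∃)
open import Data.List using (List)
open import Data.List.Membership.Propositional using (_∈_)
open import Relation.Binary.Lattice.Structures using (IsBoundedLattice)
open import Algebra.Structures using (IsCommutativeMonoid)

module ResiduatedLatticeProperties
  {c ℓ₁ ℓ₂} (A : RLSig c ℓ₁ ℓ₂) (isRL : IsResiduatedLattice A) where

  open RLSig A
  open IsResiduatedLattice isRL
  open IsBoundedLattice isBoundedLattice
    using (refl; reflexive; trans; supremum; infimum; x≤x∨y; y≤x∨y)
  open IsCommutativeMonoid isCommutativeMonoid using (comm)
  open Closure A isRL using (x⊙y≤x; x⊙y≤y)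

  ∨-least : ∀ {x y z} → x ≤ z → y ≤ z → x ∨ y ≤ z
  ∨-least {x} {y} {z} = proj₂ (proj₂ (supremum x y)) z

  ∧-greatest : ∀ {x y z} → z ≤ x → z ≤ y → z ≤ x ∧ y
  ∧-greatest {x} {y} {z} = proj₂ (proj₂ (infimum x y)) z

  ∨-monoʳ : ∀ e {x y} → x ≤ y → e ∨ x ≤ e ∨ y
  ∨-monoʳ e {x} {y} x≤y = ∨-least (x≤x∨y e y) (trans x≤y (y≤x∨y e y))

  ⊙≤∧ : ∀ x y → x ⊙ y ≤ x ∧ y
  ⊙≤∧ x y = ∧-greatest (x⊙y≤x x y) (x⊙y≤y x y)

  [x⇒y]⊙x≤y : ∀ x y → (x ⇒ y) ⊙ x ≤ y
  [x⇒y]⊙x≤y x y = residuation₁ (x ⇒ y) x y refl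

  ⊙-∨-least : ∀ {x y z d} → x ⊙ z ≤ d → y ⊙ z ≤ d → (x ∨ y) ⊙ z ≤ d
  ⊙-∨-least {x} {y} {z} {d} x⊙z≤d y⊙z≤d =
    residuation₁ (x ∨ y) z d (∨-least (residuation₂ x z d x⊙z≤d) (residuation₂ y z d y⊙z≤d))

  [e∨x]⊙z≤d : ∀ {e x z d} → e ≤ d → x ⊙ z ≤ d → (e ∨ x) ⊙ z ≤ d
  [e∨x]⊙z≤d {e} {z = z} e≤d = ⊙-∨-least (trans (x⊙y≤x e z) e≤d)

  [e∨x]⊙[e∨y]≤e∨[x⊙y] : ∀ e x y → (e ∨ x) ⊙ (e ∨ y) ≤ e ∨ (x ⊙ y)
  [e∨x]⊙[e∨y]≤e∨[x⊙y] e x y =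
    [e∨x]⊙z≤d (x≤x∨y e _)
      (trans (reflexive (comm x (e ∨ y)))
        ([e∨x]⊙z≤d (x≤x∨y e _) (trans (reflexive (comm y x)) (y≤x∨y e _))))

  ⇒-monoʳ : ∀ a {x y} → x ≤ y → a ⇒ x ≤ a ⇒ y
  ⇒-monoʳ a {x} {y} x≤y = residuation₂ (a ⇒ x) a y (trans ([x⇒y]⊙x≤y a x) x≤y)

  ⇒-antitone-∨ˡ : ∀ {e a} y → e ≤ a → y ⇒ a ≤ (e ∨ y) ⇒ a
  ⇒-antitone-∨ˡ {e} {a} y e≤a = residuation₂ (y ⇒ a) (e ∨ y) a
    (trans (reflexive (comm (y ⇒ a) (e ∨ y)))
      ([e∨x]⊙z≤d e≤a (trans (reflexive (comm y (y ⇒ a))) ([x⇒y]⊙x≤y y a))))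

module Interval
  {c ℓ₁ ℓ₂} (A : RLSig c ℓ₁ ℓ₂) (isRL : IsResiduatedLattice A)
  (e : RLSig.Carrier A) (ce : IsComplemented A e) where

  open RLSig A
  open IsResiduatedLattice isRL
  open IsBoundedLattice isBoundedLattice
    using (reflexive; trans; antisym; supremum; infimum; maximum; x≤x∨y; y≤x∨y; x∧y≤x; x∧y≤y)
  open IsCommutativeMonoid isCommutativeMonoid
    using (identityˡ; identityʳ; comm; assoc; ∙-cong)
    renaming (refl to ≈-refl; sym to ≈-sym; trans to ≈-trans)
  open Closure A isRL using (⊙-monoˡ)
  open ResiduatedLatticeProperties A isRL

  E : RLSig _ ℓ₁ ℓ₂
  E = ⟨ isRL ⟩ e ce

  module E = RLSig E

  isResiduatedLattice : IsResiduatedLattice E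
  isResiduatedLattice = record
    { isBoundedLattice = record
      { isLattice = record
        { isPartialOrder = record
          { isPreorder = record
            { isEquivalence = record { refl = ≈-refl ; sym = ≈-sym ; trans = ≈-trans }
            ; reflexive = reflexive
            ; trans = trans }
          ; antisym = antisym }
        ; supremum = λ (x , _) (y , _) → let (x≤ , y≤ , least) = supremum x y in
            x≤ , y≤ , λ z → least (proj₁ z)
        ; infimum = λ (x , _) (y , _) → let (≤x , ≤y , greatest) = infimum x y in
            ≤x , ≤y , λ z → greatest (proj₁ z) }
      ; maximum = λ x → maximum (proj₁ x)
      ; minimum = proj₂ }
    ; isCommutativeMonoid = record
      { isMonoid = record
        { isSemigroup = record
          { isMagma = record
            { isEquivalence = record { refl = ≈-refl ; sym = ≈-sym ; trans = ≈-trans }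
            ; ∙-cong = ∙-cong }
          ; assoc = λ x y z → assoc (proj₁ x) (proj₁ y) (proj₁ z) }
        ; identity = (λ x → identityˡ (proj₁ x)) , (λ x → identityʳ (proj₁ x)) }
      ; comm = λ x y → comm (proj₁ x) (proj₁ y) }
    ; residuation₁ = λ (a , _) (b , _) (c , e≤c) a≤e∨[b⇒c] →
        trans (⊙-monoˡ b a≤e∨[b⇒c]) ([e∨x]⊙z≤d e≤c ([x⇒y]⊙x≤y b c))
    ; residuation₂ = λ (a , _) (b , _) (c , _) a⊙b≤c →
        trans (residuation₂ a b c a⊙b≤c) (y≤x∨y e (b ⇒ c)) }

  lift : Carrier → E.Carrier
  lift x = e ∨ x , x≤x∨y e x

  module _ {f} {F : E.Carrier → Set f} (isF : IsFilter E F) where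
    open IsFilter isF

    lift⁻¹-isFilter : IsFilter A (F ∘ lift)
    lift⁻¹-isFilter = record
      { nonempty  = let ((x , _) , Fx) = nonempty in x , up-closed (y≤x∨y e x) Fx
      ; ⊙-closed  = λ {x} {y} Fx Fy →
          up-closed ([e∨x]⊙[e∨y]≤e∨[x⊙y] e x y) (⊙-closed Fx Fy)
      ; up-closed = λ x≤y → up-closed (∨-monoʳ e x≤y) }

    congruent-unlift : ∀ x a → Congruent E F x a → Congruent A (F ∘ lift) (proj₁ x) (proj₁ a)
    congruent-unlift (x , _) (a , _) x≡a = up-closed {x = lift u E.⊙ lift v} lift-u⊙lift-v≤ Fu⊙v
      where
      u = x ⇒ a
      v = a ⇒ x
      Fu⊙v : F (lift u E.⊙ lift v)
      Fu⊙v = ⊙-closed (up-closed (x∧y≤x _ _) x≡a) (up-closed (x∧y≤y _ _) x≡a)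
      lift-u⊙lift-v≤ : (e ∨ u) ⊙ (e ∨ v) ≤ e ∨ (u ∧ v)
      lift-u⊙lift-v≤ = trans ([e∨x]⊙[e∨y]≤e∨[x⊙y] e u v) (∨-monoʳ e (⊙≤∧ u v))

    congruent-lift : ∀ y a → Congruent A (F ∘ lift) y (proj₁ a) → Congruent E F (lift y) a
    congruent-lift y (a , e≤a) = up-closed
      (∧-greatest (∨-monoʳ e (trans (x∧y≤x _ _) (⇒-antitone-∨ˡ y e≤a)))
                  (∨-monoʳ e (trans (x∧y≤y _ _) (⇒-monoʳ a (y≤x∨y e y)))))

  isMaximal : ∀ {i f} → IsMaximal A i f → IsMaximal E i f
  isMaximal maxA I a F isF finite =
    let (y , y-solves) = solutionA in
    lift y , λ k → congruent-lift (isF k) y (a k) (y-solves k)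
    where
    G : I → Carrier → Set _
    G k = F k ∘ lift

    finiteA : (ks : List I) → ∃ λ x → ∀ k → k ∈ ks → Congruent A (G k) x (proj₁ (a k))
    finiteA ks = let (x , x-solves) = finite ks in
      proj₁ x , λ k k∈ks → congruent-unlift (isF k) x (a k) (x-solves k k∈ks)

    solutionA : ∃ λ y → ∀ k → Congruent A (G k) y (proj₁ (a k))
    solutionA = maxA I (proj₁ ∘ a) G (lift⁻¹-isFilter ∘ isF) finiteA

proposition6p3 : ∀ {c ℓ₁ ℓ₂} (A : RLSig c ℓ₁ ℓ₂) (isRL : IsResiduatedLattice A)
                 (e : RLSig.Carrier A) (ce : IsComplemented A e) (i f : Level) →
                 IsMaximal A i f →
                 IsResiduatedLattice (⟨ isRL ⟩ e ce) × IsMaximal (⟨ isRL ⟩ e ce) i f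
proposition6p3 A isRL e ce i f maxA =
  Interval.isResiduatedLattice A isRL e ce , Interval.isMaximal A isRL e ce maxA
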